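{- For every integer $k\ge 3$ there exists an algorithm (in the exploration model described in the context) that successfully explores every finite connected graph of circumference at most $k$ and that only ever assigns nonzero colors from the set $\{1,\dots,2k-1\}$.
   Context: The circumference of a graph is the length of a longest simple cycle (taken to be $0$ for acyclic graphs). Exploration model. Graphs are finite, simple, undirected and connected; vertices are anonymous and edges carry no port labels. Each vertex carries a color in $\mathbb{N}=\{0,1,2,\dots\}$, where $0$ means "uncolored"; initially all vertices have color $0$. An algorithm is a function $\mathrm{move}$ mapping every environment $(c_0,E)$ — where $c_0\in\mathbb{N}$ is the color of the agent's current vertex and $E:\mathbb{N}\to\mathbb{N}$ (zero almost everywhere) gives, for each color $c$, the number $E(c)$ of neighbors of the current vertex having color $c$ — either to $\mathrm{Stop}$ or to a pair $(c_1,d)\in\mathbb{N}\times\mathbb{N}$ with $E(d)>0$, subject to $c_1=c_0$ whenever $c_0\neq 0$ (a vertex may only be colored while it is uncolored). A run on a graph $G$: an adversary chooses a start vertex $v_0$ and places the agent there; in each step, with the agent at $v$, $\mathrm{move}$ is evaluated at the environment of $v$; if the value is $\mathrm{Stop}$ the run ends, and if it is $(c_1,d)$ then $v$ receives color $c_1$ and the adversary chooses an arbitrary neighbor of $v$ of color $d$, to which the agent moves. The agent has no other memory. A vertex is visited if the agent is located at it in some step. An algorithm successfully explores $G$ if for every adversary (every choice of start vertex and of neighbors), after finitely many steps all vertices have been visited, the agent is at $v_0$, and the decision is $\mathrm{Stop}$. -}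

module Defs where

open import Data.Nat using (ℕ; zero; suc; _+_; _*_; _∸_; _≤_; _<_; _⊔_; z≤n; s≤s; _≡ᵇ_)
open import Data.Nat.Properties using (≤-trans; m≤m⊔n; m≤n⊔m; <⇒≢; ≡ᵇ⇒≡; n≤1+n)
open import Data.Fin using (Fin; zero; suc; _≟_)
open import Data.Bool using (Bool; true; false; _∧_; T; if_then_else_)
open import Data.Bool.Properties using (∧-zeroʳ)
open import Data.Maybe using (Maybe; just; nothing)
open import Data.Product using (Σ; ∃; _×_; _,_; proj₁; proj₂)
open import Data.List using (List; []; _∷_; length; _∷ʳ_)
open import Data.List.Relation.Unary.Unique.Propositional using (Unique)
open import Data.List.Relation.Unary.Linked using (Linked)
open import Data.Empty using (⊥)
open import Relation.Nullary using (does; ¬_)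
open import Relation.Binary.PropositionalEquality using (_≡_; _≢_; refl; cong; sym; trans)

record Graph : Set where
  field
    n      : ℕ
    adj    : Fin n → Fin n → Bool
    adj-sym : ∀ u v → adj u v ≡ adj v u
    adj-irrefl : ∀ v → adj v v ≡ false

module _ (G : Graph) where
  open Graph G

  Adj : Fin n → Fin n → Set
  Adj u v = T (adj u v)

  data Walk : Fin n → Fin n → Set where
    here : ∀ {v} → Walk v v
    step : ∀ {u w v} → Adj u w → Walk w v → Walk u v

  Connected : Set
  Connected = ∀ u v → Walk u v

  IsCycle : List (Fin n) → Set
  IsCycle []       = ⊥
  IsCycle (v ∷ ws) = Unique (v ∷ ws) × 3 ≤ length (v ∷ ws) × Linked Adj ((v ∷ ws) ∷ʳ v)

  CircumferenceAtMost : ℕ → Set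
  CircumferenceAtMost k = ∀ cyc → IsCycle cyc → length cyc ≤ k

countTrue : ∀ {m} → (Fin m → Bool) → ℕ
countTrue {zero}  f = 0
countTrue {suc m} f = (if f zero then 1 else 0) + countTrue (λ i → f (suc i))

countTrue-false : ∀ {m} (f : Fin m → Bool) → (∀ i → f i ≡ false) → countTrue f ≡ 0
countTrue-false {zero}  f h = refl
countTrue-false {suc m} f h rewrite h zero = countTrue-false (λ i → f (suc i)) (λ i → h (suc i))

maxF : ∀ {m} → (Fin m → ℕ) → ℕ
maxF {zero}  f = 0
maxF {suc m} f = f zero ⊔ maxF (λ i → f (suc i))

maxF-≥ : ∀ {m} (f : Fin m → ℕ) i → f i ≤ maxF f
maxF-≥ {suc m} f zero    = m≤m⊔n (f zero) _
maxF-≥ {suc m} f (suc i) = ≤-trans (maxF-≥ (λ j → f (suc j)) i) (m≤n⊔m (f zero) _)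

record Env : Set where
  constructor mkEnv
  field
    color    : ℕ
    nbr      : ℕ → ℕ
    .finSupp : ∃ λ N → ∀ c → N ≤ c → nbr c ≡ 0

-- Stop is `nothing`; `just (c₁ , d)` = color current vertex c₁, move to a neighbour of color d
Decision : Set
Decision = Maybe (ℕ × ℕ)

record Algorithm : Set where
  field
    move  : Env → Decision
    valid : ∀ e c₁ d → move e ≡ just (c₁ , d) →
            (0 < Env.nbr e d) × (Env.color e ≢ 0 → c₁ ≡ Env.color e)

module _ (G : Graph) where
  open Graph G

  nbrCount : (Fin n → ℕ) → Fin n → ℕ → ℕ
  nbrCount col v c = countTrue (λ u → adj v u ∧ (col u ≡ᵇ c))

  private
    ≡ᵇ-false : ∀ a c → suc a ≤ c → (a ≡ᵇ c) ≡ false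
    ≡ᵇ-false a c lt with a ≡ᵇ c in eq
    ... | false = refl
    ... | true  with <⇒≢ lt ((≡ᵇ⇒≡ a c (Relation.Binary.PropositionalEquality.subst T (sym eq) _)))
    ... | ()

  nbrCount-fin : ∀ col v → ∃ λ N → ∀ c → N ≤ c → nbrCount col v c ≡ 0
  nbrCount-fin col v = suc (maxF col) , λ c le →
    countTrue-false _ (λ u → trans (cong (adj v u ∧_) (≡ᵇ-false (col u) c (≤-trans (s≤s (maxF-≥ col u)) le)))
                                   (∧-zeroʳ (adj v u)))

  envOf : (Fin n → ℕ) → Fin n → Env
  envOf col v = mkEnv (col v) (nbrCount col v) (nbrCount-fin col v)

  update : (Fin n → ℕ) → Fin n → ℕ → (Fin n → ℕ)
  update col v c u = if does (u ≟ v) then c else col u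

  module _ (A : Algorithm) (pos : ℕ → Fin n) where
    open Algorithm A

    -- the agent's positions are pos 0, pos 1, …; pos 0 is the start vertex.
    -- colAt t = coloring before step t (all 0 initially).
    stepCol : Decision → (Fin n → ℕ) → Fin n → (Fin n → ℕ)
    stepCol nothing           col v = col
    stepCol (just (c₁ , d))   col v = update col v c₁

    colAt : ℕ → Fin n → ℕ
    colAt zero    = λ _ → 0
    colAt (suc t) = stepCol (move (envOf (colAt t) (pos t))) (colAt t) (pos t)

    decAt : ℕ → Decision
    decAt t = move (envOf (colAt t) (pos t))

    Running : ℕ → Set
    Running t = ∀ s → s < t → decAt s ≢ nothing

    ValidRun : Set
    ValidRun = ∀ t c₁ d → Running t → decAt t ≡ just (c₁ , d) →
               Adj G (pos t) (pos (suc t)) × colAt t (pos (suc t)) ≡ d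

    Explored : Set
    Explored = ∃ λ T → Running T × decAt T ≡ nothing × pos T ≡ pos 0 ×
               (∀ u → ∃ λ t → t ≤ T × pos t ≡ u)

    ColorsAtMost : ℕ → Set
    ColorsAtMost b = ∀ t c₁ d → Running t → decAt t ≡ just (c₁ , d) → c₁ ≤ b

  SuccessfullyExplores : Algorithm → Set
  SuccessfullyExplores A = ∀ pos → ValidRun A pos → Explored A pos

  AssignsColorsAtMost : ℕ → Algorithm → Set
  AssignsColorsAtMost b A = ∀ pos → ValidRun A pos → ColorsAtMost A pos b

-- The explorer is a depth-first search that writes depths into the graph: the root gets colour
-- 2k − 1 and a vertex of depth d ≥ 1 gets colour 1 + (d mod (2k − 2)); the DFS stack itself is
-- never stored.  A coloured vertex that has left the stack has only coloured neighbours, so the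
-- coloured neighbours of the agent lie on the stack, and since cycles have length at most k an
-- edge joins depths differing by less than k.  So the colours seen from a vertex of depth d come
-- from depths in (d − k, d + k), and since depths less than 2k − 2 apart have distinct colours the
-- parent's colour can be recognised: an uncoloured vertex sees only depths in (d − k, d), and there
-- the parent's colour is the only present one followed cyclically by k − 1 absent colours.  Every
-- move lowers 3·#uncoloured + |stack| + [the agent stands on the top of the stack], so the run
-- stops within 3n steps, and it can only stop at the root with everything reachable coloured.

module Submission where

open import Defs
open import Data.Bool using (Bool; true; false; if_then_else_; T; _∧_)
open import Data.Bool.Properties using (T-∧)
open import Data.Empty using (⊥-elim)
open import Data.Fin using (Fin; zero; suc)
import Data.Fin.Properties as Fin
open import Data.List using (List; []; _∷_; length; _∷ʳ_)
import Data.List.Membership.DecPropositional as DecMembership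
open import Data.List.Membership.Propositional using (_∈_; _∉_)
open import Data.List.Membership.Propositional.Properties using (∈-length)
import Data.List.Relation.Unary.All as All
open import Data.List.Relation.Unary.All using (All; []; _∷_)
import Data.List.Relation.Unary.AllPairs as AllPairs
open import Data.List.Relation.Unary.AllPairs using ([]; _∷_)
open import Data.List.Relation.Unary.Any using (here; there)
import Data.List.Relation.Unary.Linked as Linked
open import Data.List.Relation.Unary.Linked using (Linked; []; [-]; _∷_)
open import Data.List.Relation.Unary.Unique.Propositional using (Unique)
import Data.Maybe as Maybe
open import Data.Maybe using (Maybe; just; nothing; maybe)
open import Data.Nat
open import Data.Nat.DivMod
open import Data.Nat.GeneralisedArithmetic using (iterate)
open import Data.Nat.Properties
open import Data.Product using (_×_; _,_; proj₁; proj₂; ∃)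
open import Data.Sum using (_⊎_; inj₁; inj₂)
open import Data.Unit using (⊤)
open import Function using (_∘_; case_of_)
open import Function.Bundles using (Equivalence)
open import Relation.Binary.PropositionalEquality
open import Relation.Nullary using (¬_; Dec; yes; no; ¬?; contradiction)
open import Relation.Nullary.Decidable using (_×-dec_; T?; toSum)

[r+i]%n≡r⇒i≡0 : ∀ n .{{_ : NonZero n}} {r i} → r < n → i < n → (r + i) % n ≡ r → i ≡ 0
[r+i]%n≡r⇒i≡0 n {r} {i} r<n i<n eq with r + i <? n
... | yes r+i<n = +-cancelˡ-≡ r i 0 (begin
  r + i        ≡⟨ m<n⇒m%n≡m r+i<n ⟨
  (r + i) % n  ≡⟨ eq ⟩
  r            ≡⟨ +-identityʳ r ⟨
  r + 0        ∎)
  where open ≡-Reasoning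
... | no r+i≮n = ⊥-elim (<⇒≢ i<n (+-cancelˡ-≡ r i n (begin
  r + i            ≡⟨ m∸n+n≡m n≤r+i ⟨
  r + i ∸ n + n    ≡⟨ cong (_+ n) wrapped ⟩
  r + n            ∎)))
  where
  open ≡-Reasoning
  n≤r+i : n ≤ r + i
  n≤r+i = ≮⇒≥ r+i≮n
  wrapped : r + i ∸ n ≡ r
  wrapped = begin
    r + i ∸ n          ≡⟨ m<n⇒m%n≡m (m<n+o⇒m∸n<o (r + i) n (+-mono-< r<n i<n)) ⟨
    (r + i ∸ n) % n    ≡⟨ m≤n⇒[n∸m]%m≡n%m n≤r+i ⟩
    (r + i) % n        ≡⟨ eq ⟩
    r                  ∎

[a+i]%n≡a%n⇒i≡0 : ∀ n .{{_ : NonZero n}} a {i} → i < n → (a + i) % n ≡ a % n → i ≡ 0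
[a+i]%n≡a%n⇒i≡0 n a {i} i<n eq = [r+i]%n≡r⇒i≡0 n (m%n<n a n) i<n (begin
  (a % n + i) % n      ≡⟨ cong (λ x → (a % n + x) % n) (m<n⇒m%n≡m i<n) ⟨
  (a % n + i % n) % n  ≡⟨ %-distribˡ-+ a i n ⟨
  (a + i) % n          ≡⟨ eq ⟩
  a % n                ∎)
  where open ≡-Reasoning

%-injective-window : ∀ n .{{_ : NonZero n}} {a b} → a ≤ b → b < a + n → a % n ≡ b % n → a ≡ b
%-injective-window n {a} {b} a≤b b<a+n eq = begin
  a                ≡⟨ +-identityʳ a ⟨
  a + 0            ≡⟨ cong (a +_) gap≡0 ⟨
  a + (b ∸ a)      ≡⟨ m+[n∸m]≡n a≤b ⟩
  b                ∎
  where
  open ≡-Reasoning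
  gap≡0 : b ∸ a ≡ 0
  gap≡0 = [a+i]%n≡a%n⇒i≡0 n a (m<n+o⇒m∸n<o b a b<a+n) (trans (cong (_% n) (m+[n∸m]≡n a≤b)) (sym eq))

countTrue-witness : ∀ {m} (f : Fin m → Bool) → 0 < countTrue f → ∃ λ i → T (f i)
countTrue-witness {suc m} f pos with f zero in f0
... | true  = zero , subst T (sym f0) _
... | false with i , fi ← countTrue-witness (f ∘ suc) pos = suc i , fi

countTrue-positive : ∀ {m} (f : Fin m → Bool) {i} → T (f i) → 0 < countTrue f
countTrue-positive {suc m} f {zero} fi with f zero
... | true = z<s
countTrue-positive {suc m} f {suc i} fi with f zero
... | true  = z<s
... | false = countTrue-positive (f ∘ suc) fi

countTrue≤ : ∀ {m} (f : Fin m → Bool) → countTrue f ≤ m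
countTrue≤ {zero}  f = z≤n
countTrue≤ {suc m} f with f zero
... | true  = s≤s (countTrue≤ (f ∘ suc))
... | false = m≤n⇒m≤1+n (countTrue≤ (f ∘ suc))

countTrue-cong : ∀ {m} {f g : Fin m → Bool} → (∀ i → f i ≡ g i) → countTrue f ≡ countTrue g
countTrue-cong {zero}          _   = refl
countTrue-cong {suc m} {f} f≗g rewrite f≗g zero = cong (_ +_) (countTrue-cong (f≗g ∘ suc))

countTrue-drop : ∀ {m} (f g : Fin m → Bool) {v} → T (f v) → ¬ T (g v) → (∀ i → i ≢ v → f i ≡ g i) →
                 countTrue f ≡ suc (countTrue g)
countTrue-drop {suc m} f g {zero} fv ¬gv f≗g with f zero | g zero
... | true | false = cong suc (countTrue-cong (λ i → f≗g (suc i) λ ()))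
... | true | true  = ⊥-elim (¬gv _)
countTrue-drop {suc m} f g {suc v} fv ¬gv f≗g rewrite f≗g zero (λ ()) with g zero
... | true  = cong suc (countTrue-drop (f ∘ suc) (g ∘ suc) fv ¬gv (λ i i≢v → f≗g (suc i) (i≢v ∘ Fin.suc-injective)))
... | false = countTrue-drop (f ∘ suc) (g ∘ suc) fv ¬gv (λ i i≢v → f≗g (suc i) (i≢v ∘ Fin.suc-injective))

module _ {A : Set} where

  prefixTo : ∀ {x : A} {xs} → x ∈ xs → List A
  prefixTo {xs = y ∷ _} (here _)  = y ∷ []
  prefixTo {xs = y ∷ _} (there p) = y ∷ prefixTo p

  prefixTo-nonempty : ∀ {x xs} (p : x ∈ xs) → 0 < length (prefixTo p)
  prefixTo-nonempty (here _)  = z<s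
  prefixTo-nonempty (there _) = z<s

  prefixTo-all : ∀ {P : A → Set} {x xs} → All P xs → (p : x ∈ xs) → All P (prefixTo p)
  prefixTo-all (px ∷ _)   (here _)  = px ∷ []
  prefixTo-all (px ∷ pxs) (there p) = px ∷ prefixTo-all pxs p

  prefixTo-unique : ∀ {x xs} → Unique xs → (p : x ∈ xs) → Unique (prefixTo p)
  prefixTo-unique (_ ∷ _)      (here _)  = [] ∷ []
  prefixTo-unique (x∉ ∷ uniq) (there p) = prefixTo-all x∉ p ∷ prefixTo-unique uniq p

  prefixTo-linked : ∀ {R : A → A → Set} {x z xs} → Linked R xs → (p : x ∈ xs) → R x z → Linked R (prefixTo p ∷ʳ z)
  prefixTo-linked _          (here refl)         xRz = xRz ∷ [-]
  prefixTo-linked (r ∷ rs) (there (here refl)) xRz = r ∷ prefixTo-linked rs (here refl) xRz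
  prefixTo-linked (r ∷ rs) (there (there p))   xRz = r ∷ prefixTo-linked rs (there p) xRz

  Heights : (A → ℕ) → List A → Set
  Heights δ []       = ⊤
  Heights δ (x ∷ xs) = δ x ≡ length xs × Heights δ xs

  heights-prefixTo : ∀ {δ x xs} → Heights δ xs → (p : x ∈ xs) → length (prefixTo p) + δ x ≡ length xs
  heights-prefixTo (δx , _)  (here refl) = cong suc δx
  heights-prefixTo (_ , hs)  (there p)   = cong suc (heights-prefixTo hs p)

  heights-< : ∀ {δ x xs} → Heights δ xs → x ∈ xs → δ x < length xs
  heights-< (δx , _)  (here refl) = s≤s (≤-reflexive δx)
  heights-< (_ , hs)  (there p)   = m≤n⇒m≤1+n (heights-< hs p)

  heights-top : ∀ {δ x y xs} → Heights δ (y ∷ xs) → x ∈ y ∷ xs → δ x ≡ δ y → x ≡ y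
  heights-top _         (here x≡y) _     = x≡y
  heights-top (δy , hs) (there p)  δx≡δy = ⊥-elim (<-irrefl (trans δx≡δy δy) (heights-< hs p))

  heights-cong : ∀ {δ δ′ xs} → (∀ {x} → x ∈ xs → δ′ x ≡ δ x) → Heights δ xs → Heights δ′ xs
  heights-cong {xs = []}     _    _         = _
  heights-cong {xs = x ∷ xs} δ′≗δ (δx , hs) = trans (δ′≗δ (here refl)) δx , heights-cong (δ′≗δ ∘ there) hs

  heights-top-unique : ∀ {δ x x′ xs} → Heights δ xs → x ∈ xs → x′ ∈ xs →
                             suc (δ x) ≡ length xs → suc (δ x′) ≡ length xs → x ≡ x′
  heights-top-unique {xs = y ∷ _} hs@(δy , _) x∈ x′∈ δx δx′ =
    trans (heights-top hs x∈ (trans (suc-injective δx) (sym δy)))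
          (sym (heights-top hs x′∈ (trans (suc-injective δx′) (sym δy))))

module _ (G : Graph) where
  open Graph G

  Adj-sym : ∀ {u v} → Adj G u v → Adj G v u
  Adj-sym {u} {v} = subst T (adj-sym u v)

  Adj⇒≢ : ∀ {u v} → Adj G u v → u ≢ v
  Adj⇒≢ {u} uAu refl = subst T (adj-irrefl u) uAu

  walk-closed : ∀ {P : Fin n → Set} → (∀ {w b} → P w → Adj G w b → P b) → ∀ {a v} → Walk G a v → P a → P v
  walk-closed closed here          Pa = Pa
  walk-closed closed (step aAw wv) Pa = walk-closed closed wv (closed Pa aAw)

  chord-bound : ∀ {K} → CircumferenceAtMost G K → 1 < K → ∀ {u x y ys} →
                Linked (Adj G) (y ∷ ys) → Unique (y ∷ ys) → All (u ≢_) (y ∷ ys) →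
                Adj G u y → (p : x ∈ y ∷ ys) → Adj G u x → length (prefixTo p) < K
  chord-bound circ 1<K path uniq u∉ uAy (here _)  uAx = 1<K
  chord-bound circ 1<K path uniq u∉ uAy (there p) uAx = circ (_ ∷ _ ∷ prefixTo p) is-cycle
    where
    is-cycle : IsCycle G (_ ∷ _ ∷ prefixTo p)
    is-cycle = prefixTo-all u∉ (there p) ∷ prefixTo-unique uniq (there p)
             , s≤s (s≤s (prefixTo-nonempty p))
             , uAy ∷ prefixTo-linked path (there p) (Adj-sym uAx)

  update-same : ∀ f v c → update G f v c v ≡ c
  update-same f v c with v Fin.≟ v
  ... | yes _   = refl
  ... | no v≢v  = ⊥-elim (v≢v refl)

  update-other : ∀ f {v} c {u} → u ≢ v → update G f v c u ≡ f u
  update-other f {v} c {u} u≢v with u Fin.≟ v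
  ... | yes u≡v = ⊥-elim (u≢v u≡v)
  ... | no _    = refl

Presence : Set
Presence = ℕ → Bool

present : Env → Presence
present e c = 0 <ᵇ Env.nbr e c

module _ (G : Graph) where
  open Graph G

  present⇒neighbour : ∀ col v {c} → T (present (envOf G col v) c) → ∃ λ b → Adj G v b × col b ≡ c
  present⇒neighbour col v {c} has-c with b , vAb∧ ← countTrue-witness _ (<ᵇ⇒< 0 _ has-c)
    with vAb , same ← Equivalence.to T-∧ vAb∧ = b , vAb , ≡ᵇ⇒≡ (col b) c same

  neighbour⇒present : ∀ col {v b c} → Adj G v b → col b ≡ c → T (present (envOf G col v) c)
  neighbour⇒present col {v} {b} {c} vAb refl =
    <⇒<ᵇ (countTrue-positive (λ u → adj v u ∧ (col u ≡ᵇ col b))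
                             (Equivalence.from T-∧ (vAb , ≡⇒≡ᵇ (col b) (col b) refl)))

-- Depth colours

module DepthColouring (j : ℕ) where

  k : ℕ
  k = 3 + j

  period : ℕ
  period = k + (k ∸ 2)

  rootColour : ℕ
  rootColour = suc period

  depthColour : ℕ → ℕ
  depthColour zero    = rootColour
  depthColour (suc d) = suc (suc d % period)

  depthColour≢0 : ∀ d → depthColour d ≢ 0
  depthColour≢0 zero    ()
  depthColour≢0 (suc d) ()

  depthColour-suc≤period : ∀ d → depthColour (suc d) ≤ period
  depthColour-suc≤period d = m%n<n (suc d) period

  depthColour-suc≢root : ∀ d → depthColour (suc d) ≢ rootColour
  depthColour-suc≢root d eq = 1+n≰n (subst (_≤ period) eq (depthColour-suc≤period d))

  depthColour-injective : ∀ {a b} → depthColour a ≡ depthColour b → a < b + period → b < a + period → a ≡ b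
  depthColour-injective {zero}  {zero}  _  _ _ = refl
  depthColour-injective {zero}  {suc b} eq _ _ = ⊥-elim (depthColour-suc≢root b (sym eq))
  depthColour-injective {suc a} {zero}  eq _ _ = ⊥-elim (depthColour-suc≢root a eq)
  depthColour-injective {suc a} {suc b} eq a<b+p b<a+p with ≤-total (suc a) (suc b)
  ... | inj₁ a≤b = %-injective-window period a≤b b<a+p (suc-injective eq)
  ... | inj₂ b≤a = sym (%-injective-window period b≤a a<b+p (sym (suc-injective eq)))

  childColour : ℕ → ℕ
  childColour c with c ≟ period | c ≟ rootColour
  ... | yes _ | _     = 1
  ... | no _  | yes _ = 2
  ... | no _  | no _  = suc c

  childColour-period : childColour period ≡ 1
  childColour-period with period ≟ period
  ... | yes _  = refl
  ... | no p≢p = ⊥-elim (p≢p refl)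

  childColour-root : childColour rootColour ≡ 2
  childColour-root with rootColour ≟ period | rootColour ≟ rootColour
  ... | yes r≡p | _      = ⊥-elim (<⇒≢ (n<1+n period) (sym r≡p))
  ... | no _    | yes _  = refl
  ... | no _    | no r≢r = ⊥-elim (r≢r refl)

  childColour-< : ∀ {c} → c < period → childColour c ≡ suc c
  childColour-< {c} c<p with c ≟ period | c ≟ rootColour
  ... | yes refl | _        = ⊥-elim (<-irrefl refl c<p)
  ... | no _     | yes refl = ⊥-elim (<-asym c<p (n<1+n period))
  ... | no _     | no _     = refl

  depthColour-suc : ∀ d → depthColour (suc d) ≡ childColour (depthColour d)
  depthColour-suc zero    = sym childColour-root
  depthColour-suc (suc d) with m≤n⇒m<n∨m≡n (m%n<n (suc d) period)
  ... | inj₁ r<p = begin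
    suc (suc (suc d) % period)            ≡⟨ cong suc (%-distribˡ-+ 1 (suc d) period) ⟩
    suc (suc (suc d % period) % period)   ≡⟨ cong suc (m<n⇒m%n≡m r<p) ⟩
    suc (suc (suc d % period))            ≡⟨ childColour-< r<p ⟨
    childColour (suc (suc d % period))    ∎
    where open ≡-Reasoning
  ... | inj₂ r≡p = begin
    suc (suc (suc d) % period)            ≡⟨ cong suc (%-distribˡ-+ 1 (suc d) period) ⟩
    suc (suc (suc d % period) % period)   ≡⟨ cong (λ x → suc (x % period)) r≡p ⟩
    suc (period % period)                 ≡⟨ cong suc (n%n≡0 period) ⟩
    1                                     ≡⟨ childColour-period ⟨
    childColour period                    ≡⟨ cong childColour r≡p ⟨
    childColour (suc (suc d % period))    ∎
    where open ≡-Reasoning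

  iterate-childColour : ∀ d i → iterate childColour (depthColour d) i ≡ depthColour (d + i)
  iterate-childColour d zero    = cong depthColour (sym (+-identityʳ d))
  iterate-childColour d (suc i) = begin
    iterate childColour (childColour (depthColour d)) i  ≡⟨ cong (λ c → iterate childColour c i) (depthColour-suc d) ⟨
    iterate childColour (depthColour (suc d)) i          ≡⟨ iterate-childColour (suc d) i ⟩
    depthColour (suc d + i)                              ≡⟨ cong depthColour (+-suc d i) ⟨
    depthColour (d + suc i)                              ∎
    where open ≡-Reasoning

  prevColour : ℕ → ℕ
  prevColour 1 = period
  prevColour c = pred c

  prevColour-childColour : ∀ {c} → 0 < c → c ≤ period → prevColour (childColour c) ≡ c
  prevColour-childColour {c} 0<c c≤p with m≤n⇒m<n∨m≡n c≤p
  ... | inj₂ refl = cong prevColour childColour-period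
  ... | inj₁ c<p rewrite childColour-< c<p with c | 0<c
  ...   | suc _ | _ = refl

  prevColour-depthColour : ∀ d → prevColour (depthColour (suc (suc d))) ≡ depthColour (suc d)
  prevColour-depthColour d = begin
    prevColour (depthColour (suc (suc d)))         ≡⟨ cong prevColour (depthColour-suc (suc d)) ⟩
    prevColour (childColour (depthColour (suc d))) ≡⟨ prevColour-childColour z<s (depthColour-suc≤period d) ⟩
    depthColour (suc d)                            ∎
    where open ≡-Reasoning

  rootColour≡2k-1 : rootColour ≡ 2 * k ∸ 1
  rootColour≡2k-1 = begin
    suc (k + (k ∸ 2))   ≡⟨ +-suc k (k ∸ 2) ⟨
    k + (k ∸ 1)         ≡⟨ +-∸-assoc k {k} (s≤s z≤n) ⟨
    k + k ∸ 1           ≡⟨ cong (λ x → k + x ∸ 1) (+-identityʳ k) ⟨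
    2 * k ∸ 1           ∎
    where open ≡-Reasoning

  k<period : k < period
  k<period = m<m+n k z<s

  k≤period : k ≤ period
  k≤period = <⇒≤ k<period

  window-spread : ∀ {d e i} → d < e + k → i < k ∸ 1 → d + i < e + period
  window-spread {d} {e} {i} d<e+k i<k-1 = subst (d + i <_) (+-assoc e k (k ∸ 2)) (+-mono-<-≤ d<e+k (≤-pred i<k-1))

-- The explorer

module DfsExplorer (j : ℕ) where
  open DepthColouring j public

  ifPresent : Presence → ℕ → Maybe ℕ
  ifPresent has c = if has c then just c else nothing

  ParentCandidate : Presence → ℕ → Set
  ParentCandidate has c = 0 < c × T (has c) × (∀ {i} → i < k ∸ 1 → ¬ T (has (iterate childColour c (suc i))))

  parentCandidate? : ∀ has c → Dec (ParentCandidate has c)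
  parentCandidate? has c =
    0 <? c ×-dec T? (has c) ×-dec allUpTo? (λ i → ¬? (T? (has (iterate childColour c (suc i))))) (k ∸ 1)

  uncolouredParent : Presence → Maybe ℕ
  uncolouredParent has with anyUpTo? (parentCandidate? has) rootColour
  ... | yes (c , _ , _) = just c
  ... | no _            = ifPresent has rootColour

  -- Colour 2 marks depth 1, whose parent is the root, but also depth 2k − 1, which is too deep
  -- to be adjacent to the root.
  backColour : Presence → ℕ → ℕ
  backColour has 2 = if has rootColour then rootColour else 1
  backColour has c = prevColour c

  parentColour : ℕ → Presence → Maybe ℕ
  parentColour zero    has = uncolouredParent has
  parentColour (suc c) has with suc c ≟ rootColour
  ... | yes _ = nothing
  ... | no _  = ifPresent has (backColour has (suc c))

  ownColour : ℕ → Maybe ℕ → ℕ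
  ownColour zero    p = maybe childColour rootColour p
  ownColour (suc c) _ = suc c

  decide : ℕ → Presence → Decision
  decide c has = if has 0 then just (own , 0) else Maybe.map (own ,_) parent
    where
    parent : Maybe ℕ
    parent = parentColour c has
    own : ℕ
    own = ownColour c parent

  ifPresent-just : ∀ has {c p} → ifPresent has c ≡ just p → p ≡ c × T (has c)
  ifPresent-just has {c} eq with has c
  ... | true with refl ← eq = refl , _

  parentColour-present : ∀ c has {p} → parentColour c has ≡ just p → T (has p)
  parentColour-present zero has eq with anyUpTo? (parentCandidate? has) rootColour
  ... | yes (_ , _ , _ , present , _) with refl ← eq = present
  ... | no _ with refl , present ← ifPresent-just has eq = present
  parentColour-present (suc c) has eq with suc c ≟ rootColour
  ... | no _ with refl , present ← ifPresent-just has eq = present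

  ownColour-coloured : ∀ c {p} → c ≢ 0 → ownColour c p ≡ c
  ownColour-coloured zero    c≢0 = ⊥-elim (c≢0 refl)
  ownColour-coloured (suc c) _   = refl

  decide-target-present : ∀ c has {c₁ d} → decide c has ≡ just (c₁ , d) → T (has d)
  decide-target-present c has eq with has 0 in has0 | parentColour c has in parent
  ... | true  | _      with refl ← eq = subst T (sym has0) _
  ... | false | just p with refl ← eq = parentColour-present c has parent

  decide-ownColour : ∀ c has {c₁ d} → decide c has ≡ just (c₁ , d) → c₁ ≡ ownColour c (parentColour c has)
  decide-ownColour c has eq with has 0 | parentColour c has
  ... | true  | _      with refl ← eq = refl
  ... | false | just p with refl ← eq = refl

  childColour-≤root : ∀ {c} → c ≤ rootColour → childColour c ≤ rootColour
  childColour-≤root {c} c≤R with c ≟ period | c ≟ rootColour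
  ... | yes _ | _       = s≤s z≤n
  ... | no _  | yes _   = s≤s (s≤s z≤n)
  ... | no _  | no c≢R  = ≤∧≢⇒< c≤R c≢R

  uncolouredParent-≤root : ∀ has {p} → uncolouredParent has ≡ just p → p ≤ rootColour
  uncolouredParent-≤root has eq with anyUpTo? (parentCandidate? has) rootColour
  ... | yes (_ , c<R , _) with refl ← eq = <⇒≤ c<R
  ... | no _ with refl , _ ← ifPresent-just has eq = ≤-refl

  ownColour-≤root : ∀ c has → c ≤ rootColour → ownColour c (parentColour c has) ≤ rootColour
  ownColour-≤root zero    has _ with uncolouredParent has in parent
  ... | just p  = childColour-≤root (uncolouredParent-≤root has parent)
  ... | nothing = ≤-refl
  ownColour-≤root (suc c) has c≤R = c≤R

  decide-≤root : ∀ c has {c₁ d} → c ≤ rootColour → decide c has ≡ just (c₁ , d) → c₁ ≤ rootColour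
  decide-≤root c has c≤R eq = subst (_≤ rootColour) (sym (decide-ownColour c has eq)) (ownColour-≤root c has c≤R)

  ifPresent-present : ∀ {has c} → T (has c) → ifPresent has c ≡ just c
  ifPresent-present {has} {c} present with has c
  ... | true = refl

  parentAt : ℕ → Maybe ℕ
  parentAt zero    = nothing
  parentAt (suc d) = just (depthColour d)

  DepthWindow : Presence → ℕ → ℕ → Set
  DepthWindow has d b = ∀ {c} → c ≢ 0 → T (has c) → ∃ λ e → c ≡ depthColour e × d < e + k × e < b

  ParentPresent : Presence → ℕ → Set
  ParentPresent has zero    = ⊤
  ParentPresent has (suc d) = T (has (depthColour d))

  candidate-excludes : ∀ {has a b} → (∀ {i} → i < k ∸ 1 → ¬ T (has (iterate childColour (depthColour a) (suc i)))) →
                       a < b → b < a + k → ¬ T (has (depthColour b))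
  candidate-excludes {has} {a} clear a<b b<a+k with m≤n⇒∃[o]m+o≡n a<b
  ... | o , refl = clear o<k-1 ∘ subst (T ∘ has) (trans (cong depthColour (sym (+-suc a o))) (sym (iterate-childColour a (suc o))))
    where
    o<k-1 : o < k ∸ 1
    o<k-1 = ≤-pred (+-cancelˡ-≤ a (2 + o) k (subst (_≤ a + k) (sym a+[2+o]≡) b<a+k))
      where
      a+[2+o]≡ : a + (2 + o) ≡ 2 + (a + o)
      a+[2+o]≡ = trans (+-suc a (suc o)) (cong suc (+-suc a o))

  candidate-is-parent : ∀ {has d c} → DepthWindow has d d → ParentPresent has d → c < rootColour → ParentCandidate has c →
                        parentAt d ≡ just c
  candidate-is-parent {has} window parent c<R (0<c , present , clear) with window (n>0⇒n≢0 0<c) present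
  ... | zero  , refl , _ , _ = ⊥-elim (<-irrefl refl c<R)
  ... | suc e , refl , d<e+k , s≤s e≤d' with m≤n⇒m<n∨m≡n e≤d'
  ...   | inj₂ refl = refl
  ...   | inj₁ e<d' = ⊥-elim (candidate-excludes {has} clear e<d' (<-trans (n<1+n _) d<e+k) parent)

  parent-is-candidate : ∀ {has e} → DepthWindow has (2 + e) (2 + e) → T (has (depthColour (suc e))) →
                        ParentCandidate has (depthColour (suc e))
  parent-is-candidate {has} {e} window present = z<s , present , absent
    where
    absent : ∀ {i} → i < k ∸ 1 → ¬ T (has (iterate childColour (depthColour (suc e)) (suc i)))
    absent {i} i<k-1 present′
      with window (depthColour≢0 (suc e + suc i)) (subst (T ∘ has) (iterate-childColour (suc e) (suc i)) present′)
    ... | e′ , same , d<e′+k , e′<d = <⇒≱ e′<d (subst (2 + e ≤_) (sym e′≡) d≤)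
      where
      d≤ : 2 + e ≤ suc e + suc i
      d≤ = s≤s (subst (suc e ≤_) (sym (+-suc e i)) (s≤s (m≤m+n e i)))
      e′≡ : e′ ≡ suc e + suc i
      e′≡ = depthColour-injective (sym same)
              (<-≤-trans e′<d (≤-trans d≤ (m≤m+n _ period)))
              (subst (_< e′ + period) (sym (+-suc (suc e) i)) (window-spread d<e′+k i<k-1))

  uncolouredParent-at : ∀ {has} d → DepthWindow has d d → ParentPresent has d → uncolouredParent has ≡ parentAt d
  uncolouredParent-at {has} d window parent with anyUpTo? (parentCandidate? has) rootColour
  ... | yes (c , c<R , candidate) = sym (candidate-is-parent window parent c<R candidate)
  ... | no none = no-candidate d window parent
    where
    no-candidate : ∀ d → DepthWindow has d d → ParentPresent has d → ifPresent has rootColour ≡ parentAt d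
    no-candidate zero window _ with has rootColour in root
    ... | false = refl
    ... | true with window (λ ()) (subst T (sym root) _)
    ...   | _ , _ , _ , ()
    no-candidate (suc zero)    _      parent = ifPresent-present {has} parent
    no-candidate (suc (suc e)) window parent =
      ⊥-elim (none (depthColour (suc e) , s≤s (depthColour-suc≤period e) , parent-is-candidate {has} window parent))

  backColour-prev : ∀ {has c} → (c ≡ 2 → ¬ T (has rootColour)) → backColour has c ≡ prevColour c
  backColour-prev {c = 0}             _ = refl
  backColour-prev {c = 1}             _ = refl
  backColour-prev {has} {c = 2} no-root with has rootColour
  ... | false = refl
  ... | true  = ⊥-elim (no-root refl _)
  backColour-prev {c = suc (suc (suc _))} _ = refl

  backColour-depthColour : ∀ {has} e → DepthWindow has (suc e) (suc e + k) → ParentPresent has (suc e) →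
                           backColour has (depthColour (suc e)) ≡ depthColour e
  backColour-depthColour {has} zero _ root with has rootColour
  ... | true = refl
  backColour-depthColour {has} (suc e) window _ = trans (backColour-prev {has} no-root) (prevColour-depthColour e)
    where
    no-root : depthColour (2 + e) ≡ 2 → ¬ T (has rootColour)
    no-root coloured-2 root with window (λ ()) root
    ... | suc e′ , R≡ , _       = depthColour-suc≢root e′ (sym R≡)
    ... | zero   , _  , d<k , _ with depthColour-injective {2 + e} {1} coloured-2
                                       (<-≤-trans d<k (≤-trans (m≤m+n k (k ∸ 2)) (n≤1+n period))) (s≤s (s≤s (m≤m+n 0 _)))
    ...   | ()

  parentColour-at : ∀ {has} d → DepthWindow has d (d + k) → ParentPresent has d →
                    parentColour (depthColour d) has ≡ parentAt d
  parentColour-at zero _ _ with rootColour ≟ rootColour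
  ... | yes _   = refl
  ... | no R≢R  = ⊥-elim (R≢R refl)
  parentColour-at {has} (suc e) window parent with depthColour (suc e) ≟ rootColour
  ... | yes C≡R = ⊥-elim (depthColour-suc≢root e C≡R)
  ... | no _    = trans (cong (ifPresent has) (backColour-depthColour e window parent)) (ifPresent-present {has} parent)

  dfsStep : Presence → ℕ → Decision
  dfsStep has d = if has 0 then just (depthColour d , 0) else Maybe.map (depthColour d ,_) (parentAt d)

  decide-dfs : ∀ c has {d} → parentColour c has ≡ parentAt d → ownColour c (parentAt d) ≡ depthColour d →
               decide c has ≡ dfsStep has d
  decide-dfs c has parent own rewrite parent | own = refl

  decide-uncoloured : ∀ {has} d → DepthWindow has d d → ParentPresent has d → decide 0 has ≡ dfsStep has d
  decide-uncoloured {has} d window parent = decide-dfs 0 has (uncolouredParent-at d window parent) (own d)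
    where
    own : ∀ d → ownColour 0 (parentAt d) ≡ depthColour d
    own zero    = refl
    own (suc d) = sym (depthColour-suc d)

  decide-coloured : ∀ {has} d → DepthWindow has d (d + k) → ParentPresent has d →
                    decide (depthColour d) has ≡ dfsStep has d
  decide-coloured {has} d window parent =
    decide-dfs (depthColour d) has (parentColour-at d window parent) (ownColour-coloured _ (depthColour≢0 d))

  dfsExplorer : Algorithm
  dfsExplorer = record
    { move  = λ e → decide (Env.color e) (present e)
    ; valid = λ e _ _ eq → <ᵇ⇒< 0 _ (decide-target-present (Env.color e) (present e) eq)
                         , λ c≢0 → trans (decide-ownColour (Env.color e) (present e) eq) (ownColour-coloured _ c≢0)
    }

  data DfsMove (has : Presence) (d : ℕ) : Decision → Set where
    descend : T (has 0) → DfsMove has d (just (depthColour d , 0))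
    retreat : ∀ {e} → ¬ T (has 0) → d ≡ suc e → DfsMove has d (just (depthColour d , depthColour e))
    halt    : ¬ T (has 0) → d ≡ 0 → DfsMove has d nothing

  dfsMove : ∀ has d → DfsMove has d (dfsStep has d)
  dfsMove has d with has 0 in has0
  ... | true = descend (subst T (sym has0) _)
  dfsMove has zero    | false = halt (subst T has0) refl
  dfsMove has (suc d) | false = retreat (subst T has0) refl

-- Runs of the explorer

module DfsRun (j : ℕ) (G : Graph) (pos : ℕ → Fin (Graph.n G)) where
  open DfsExplorer j
  open Graph G
  open DecMembership (Fin._≟_ {n}) using (_∈?_)

  V : Set
  V = Fin n

  col : ℕ → V → ℕ
  col = colAt G dfsExplorer pos

  dec : ℕ → Decision
  dec = decAt G dfsExplorer pos

  Runs : ℕ → Set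
  Runs = Running G dfsExplorer pos

  has : ℕ → V → Presence
  has t v = present (envOf G (col t) v)

  colour-step : ∀ {t c₁ d} → dec t ≡ just (c₁ , d) → ∀ w → col (suc t) w ≡ update G (col t) (pos t) c₁ w
  colour-step {t} eq w rewrite eq = refl

  col≤root : ∀ t w → col t w ≤ rootColour
  col≤root zero    w = z≤n
  col≤root (suc t) w with dec t in eq
  ... | nothing       = col≤root t w
  ... | just (c₁ , d) with w Fin.≟ pos t
  ...   | yes refl = decide-≤root _ _ (col≤root t (pos t)) eq
  ...   | no _     = col≤root t w

  halts-or-runs : ∀ t → Runs t ⊎ ∃ λ s → Runs s × dec s ≡ nothing
  halts-or-runs zero = inj₁ λ _ ()
  halts-or-runs (suc t) with halts-or-runs t
  ... | inj₂ halted = inj₂ halted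
  ... | inj₁ run with dec t in eq
  ...   | nothing = inj₂ (t , run , eq)
  ...   | just _  = inj₁ run′
    where
    run′ : Runs (suc t)
    run′ s s<1+t with m<1+n⇒m<n∨m≡n s<1+t
    ... | inj₁ s<t  = run s s<t
    ... | inj₂ refl = λ stop → case trans (sym eq) stop of λ ()

  colours-bounded : ColorsAtMost G dfsExplorer pos rootColour
  colours-bounded t _ _ _ eq = decide-≤root _ _ (col≤root t (pos t)) eq

  Coloured : (V → ℕ) → V → Set
  Coloured c v = c v ≢ 0

  record Labelling (c : V → ℕ) (depth : V → ℕ) : Set where
    field
      colour-depth  : ∀ {w} → Coloured c w → c w ≡ depthColour (depth w)
      depth0-root   : ∀ {w} → Coloured c w → depth w ≡ 0 → w ≡ pos 0
      edge-depth    : ∀ {a b} → Coloured c a → Coloured c b → Adj G a b → depth b < depth a + k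
      parent-unique : ∀ {w x x′} → Coloured c w → Coloured c x → Coloured c x′ → Adj G w x → Adj G w x′ →
                      suc (depth x) ≡ depth w → suc (depth x′) ≡ depth w → x ≡ x′

  labelling-cong : ∀ {c c′ δ} → (∀ w → c′ w ≡ c w) → Labelling c δ → Labelling c′ δ
  labelling-cong {c} {c′} c′≗c lab = record
    { colour-depth  = λ w-col → trans (c′≗c _) (colour-depth (back w-col))
    ; depth0-root   = λ w-col → depth0-root (back w-col)
    ; edge-depth    = λ a-col b-col → edge-depth (back a-col) (back b-col)
    ; parent-unique = λ w-col x-col x′-col → parent-unique (back w-col) (back x-col) (back x′-col)
    }
    where
    open Labelling lab
    back : ∀ {w} → Coloured c′ w → Coloured c w
    back w-col = w-col ∘ trans (c′≗c _)

  labelling-extend : ∀ {c δ u L} → Labelling c δ →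
    (∀ {b} → Adj G u b → Coloured c b → δ b < L × L < δ b + k) →
    (∀ {x x′} → Coloured c x → Coloured c x′ → Adj G u x → Adj G u x′ → suc (δ x) ≡ L → suc (δ x′) ≡ L → x ≡ x′) →
    (L ≡ 0 → u ≡ pos 0) →
    Labelling (update G c u (depthColour L)) (update G δ u L)
  labelling-extend {c} {δ} {u} {L} lab window parent root = record
    { colour-depth  = colour-depth′
    ; depth0-root   = depth0-root′
    ; edge-depth    = edge-depth′
    ; parent-unique = parent-unique′
    }
    where
    open Labelling lab
    c′ : V → ℕ
    c′ = update G c u (depthColour L)
    δ′ : V → ℕ
    δ′ = update G δ u L

    old : ∀ {w} → w ≢ u → Coloured c′ w → Coloured c w
    old w≢u w-col = w-col ∘ trans (update-other G c _ w≢u)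

    colour-depth′ : ∀ {w} → Coloured c′ w → c′ w ≡ depthColour (δ′ w)
    colour-depth′ {w} w-col with w Fin.≟ u
    ... | yes refl = refl
    ... | no w≢u   = colour-depth w-col

    depth0-root′ : ∀ {w} → Coloured c′ w → δ′ w ≡ 0 → w ≡ pos 0
    depth0-root′ {w} w-col with w Fin.≟ u
    ... | yes refl = root
    ... | no w≢u   = depth0-root w-col

    edge-depth′ : ∀ {a b} → Coloured c′ a → Coloured c′ b → Adj G a b → δ′ b < δ′ a + k
    edge-depth′ {a} {b} a-col b-col aAb with a Fin.≟ u | b Fin.≟ u
    ... | yes refl | yes refl = ⊥-elim (Adj⇒≢ G aAb refl)
    ... | yes refl | no b≢u =
      <-≤-trans (proj₁ (window aAb b-col)) (m≤m+n L k)
    ... | no a≢u | yes refl =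
      proj₂ (window (Adj-sym G aAb) a-col)
    ... | no a≢u | no b≢u =
      edge-depth a-col b-col aAb

    not-below : ∀ {w} → Coloured c w → Adj G w u → suc L ≢ δ w
    not-below w-col wAu eq = <⇒≱ (proj₁ (window (Adj-sym G wAu) w-col)) (≤-trans (n≤1+n L) (≤-reflexive eq))

    parent-unique′ : ∀ {w x x′} → Coloured c′ w → Coloured c′ x → Coloured c′ x′ → Adj G w x → Adj G w x′ →
                     suc (δ′ x) ≡ δ′ w → suc (δ′ x′) ≡ δ′ w → x ≡ x′
    parent-unique′ {w} {x} {x′} w-col x-col x′-col wAx wAx′ ex ex′ with w Fin.≟ u
    ... | yes refl =
      parent (old x≢u x-col) (old x′≢u x′-col) wAx wAx′
             (trans (cong suc (sym (update-other G δ L x≢u))) ex)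
             (trans (cong suc (sym (update-other G δ L x′≢u))) ex′)
      where
      x≢u : x ≢ w
      x≢u = Adj⇒≢ G wAx ∘ sym
      x′≢u : x′ ≢ w
      x′≢u = Adj⇒≢ G wAx′ ∘ sym
    ... | no w≢u with x Fin.≟ u | x′ Fin.≟ u
    ...   | yes refl | _        = ⊥-elim (not-below w-col wAx ex)
    ...   | no _     | yes refl = ⊥-elim (not-below w-col wAx′ ex′)
    ...   | no _     | no _     = parent-unique w-col x-col x′-col wAx wAx′ ex ex′

  colour-kept : ∀ {t c₁ d w} → dec t ≡ just (c₁ , d) → (w ≡ pos t → Coloured (col t) w) → col (suc t) w ≡ col t w
  colour-kept {t} {w = w} eq coloured-if-here = trans (colour-step eq w) kept
    where
    kept : update G (col t) (pos t) _ w ≡ col t w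
    kept with w Fin.≟ pos t
    ... | yes refl = proj₂ (Algorithm.valid dfsExplorer (envOf G (col t) (pos t)) _ _ eq) (coloured-if-here refl)
    ... | no _     = refl

  AttachedTo : List V → V → Set
  AttachedTo []      v = v ≡ pos 0
  AttachedTo (y ∷ _) v = Adj G y v

  NextTo : V → List V → Set
  NextTo u []      = ⊤
  NextTo u (y ∷ _) = Adj G u y

  attached⇒nextTo : ∀ {u} L → AttachedTo L u → NextTo u L
  attached⇒nextTo []      _   = _
  attached⇒nextTo (_ ∷ _) yAu = Adj-sym G yAu

  linked⇒nextTo : ∀ {u} L → Linked (Adj G) (u ∷ L) → NextTo u L
  linked⇒nextTo []      _         = _
  linked⇒nextTo (_ ∷ _) (uAy ∷ _) = uAy

  attached-root : ∀ {u} L → AttachedTo L u → length L ≡ 0 → u ≡ pos 0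
  attached-root [] u≡root _ = u≡root

  push-linked : ∀ {u} L → AttachedTo L u → Linked (Adj G) L → Linked (Adj G) (u ∷ L)
  push-linked []      _   _    = [-]
  push-linked (_ ∷ _) yAu path = Adj-sym G yAu ∷ path

  budget-step : ∀ {t P P′ B} → P′ < P → t + P ≤ B → suc t + P′ ≤ B
  budget-step {t} {P} {P′} P′<P t+P≤B = ≤-trans (≤-reflexive (sym (+-suc t P′))) (≤-trans (+-monoʳ-≤ t P′<P) t+P≤B)

  data Phase (t : ℕ) : List V → Set where
    entering : ∀ {stack} → col t (pos t) ≡ 0 → AttachedTo stack (pos t) → Phase t stack
    atTop    : ∀ {top rest} → top ≡ pos t → Phase t (top ∷ rest)

  uncoloured : ℕ → ℕ
  uncoloured t = countTrue (λ w → col t w ≡ᵇ 0)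

  -- Colouring a vertex removes 3 from the first summand and adds at most 2 to the others.
  potential : ∀ {t stack} → Phase t stack → ℕ
  potential {t} {stack} (entering _ _) = 3 * uncoloured t + length stack
  potential {t} {stack} (atTop _)      = suc (3 * uncoloured t + length stack)

  top-colour : ∀ {c δ u r} → Labelling c δ → Heights δ (u ∷ r) → All (Coloured c) (u ∷ r) → c u ≡ depthColour (length r)
  top-colour lab (δu , _) (u-col ∷ _) = trans (Labelling.colour-depth lab u-col) (cong depthColour δu)

  parent-present : ∀ {t δ u} L → Labelling (col t) δ → Heights δ L → All (Coloured (col t)) L → NextTo u L →
                   ParentPresent (has t u) (length L)
  parent-present []      _   _  _  _   = _
  parent-present {t} (y ∷ r) lab hs cs uAy = neighbour⇒present G (col t) uAy (top-colour lab hs cs)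

  module Invariant (circ : CircumferenceAtMost G k) (valid : ValidRun G dfsExplorer pos) where

    chord-depth : ∀ {δ u b} L → Linked (Adj G) L → Unique L → Heights δ L → All (u ≢_) L → AttachedTo L u →
                  b ∈ L → Adj G u b → length L < δ b + k
    chord-depth {δ} {b = b} (y ∷ r) path uniq hs u∉ yAu b∈ uAb = begin-strict
      length (y ∷ r)                   ≡⟨ heights-prefixTo hs b∈ ⟨
      length (prefixTo b∈) + δ b       <⟨ +-monoˡ-< (δ b) chord ⟩
      k + δ b                          ≡⟨ +-comm k (δ b) ⟩
      δ b + k                          ∎
      where
      open ≤-Reasoning
      chord : length (prefixTo b∈) < k
      chord = chord-bound G circ (s≤s (s≤s z≤n)) path uniq u∉ (Adj-sym G yAu) b∈ uAb

    record DfsState (t : ℕ) (stack : List V) : Set where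
      field
        depth          : V → ℕ
        labelling      : Labelling (col t) depth
        stack-path     : Linked (Adj G) stack
        stack-unique   : Unique stack
        stack-heights  : Heights depth stack
        stack-coloured : All (Coloured (col t)) stack
        finished       : ∀ {w b} → Coloured (col t) w → w ∉ stack → Adj G w b → Coloured (col t) b
        visited        : ∀ {w} → Coloured (col t) w → ∃ λ s → s ≤ t × pos s ≡ w
        phase          : Phase t stack
        budget         : t + potential phase ≤ 3 * n
      open Labelling labelling public

    initial : DfsState 0 []
    initial = record
      { depth          = λ _ → 0
      ; labelling      = record { colour-depth = contradiction refl ; depth0-root = contradiction refl
                                ; edge-depth = contradiction refl ; parent-unique = contradiction refl }
      ; stack-path     = []
      ; stack-unique   = []
      ; stack-heights  = _
      ; stack-coloured = []
      ; finished       = contradiction refl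
      ; visited        = contradiction refl
      ; phase          = entering refl refl
      ; budget         = subst (_≤ 3 * n) (sym (+-identityʳ _)) (*-monoʳ-≤ 3 (countTrue≤ (λ w → col 0 w ≡ᵇ 0)))
      }

    stays-coloured : ∀ {t c₁ d w} → dec t ≡ just (c₁ , d) → Coloured (col t) w → Coloured (col (suc t)) w
    stays-coloured eq w-col = w-col ∘ trans (sym (colour-kept eq (λ _ → w-col)))

    neighbours-coloured : ∀ {t u b} → ¬ T (has t u 0) → Adj G u b → Coloured (col t) b
    neighbours-coloured {t} ¬has0 uAb b0 = ¬has0 (neighbour⇒present G (col t) uAb b0)

    module Entering {t stack} (S : DfsState t stack) where
      open DfsState S

      off-stack : ∀ {u} → col t u ≡ 0 → All (u ≢_) stack
      off-stack u0 = All.map (λ v-col u≡v → v-col (subst (λ x → col t x ≡ 0) u≡v u0)) stack-coloured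

      neighbour-on-stack : ∀ {u b} → col t u ≡ 0 → Adj G u b → Coloured (col t) b → b ∈ stack
      neighbour-on-stack {u} {b} u0 uAb b-col with b ∈? stack
      ... | yes b∈ = b∈
      ... | no b∉  = ⊥-elim (finished b-col b∉ (Adj-sym G uAb) u0)

      neighbour-window : ∀ {u b} → col t u ≡ 0 → AttachedTo stack u → Adj G u b → Coloured (col t) b →
                         depth b < length stack × length stack < depth b + k
      neighbour-window {b = b} u0 att uAb b-col =
        heights-< stack-heights b∈ , chord-depth stack stack-path stack-unique stack-heights (off-stack u0) att b∈ uAb
        where
        b∈ : b ∈ stack
        b∈ = neighbour-on-stack u0 uAb b-col

      entering-window : ∀ {u} → col t u ≡ 0 → AttachedTo stack u → DepthWindow (has t u) (length stack) (length stack)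
      entering-window {u} u0 att c≢0 has-c with present⇒neighbour G (col t) u has-c
      ... | b , uAb , refl with below , within ← neighbour-window u0 att uAb c≢0 = depth b , colour-depth c≢0 , within , below

      decision : col t (pos t) ≡ 0 → AttachedTo stack (pos t) → dec t ≡ dfsStep (has t (pos t)) (length stack)
      decision u0 att = trans (cong (λ c → decide c (has t (pos t))) u0)
        (decide-uncoloured (length stack) (entering-window u0 att)
          (parent-present {t} stack labelling stack-heights stack-coloured (attached⇒nextTo stack att)))

    module AtTop {t r} (S : DfsState t (pos t ∷ r)) where
      open DfsState S

      u-coloured : Coloured (col t) (pos t)
      u-coloured = All.head stack-coloured

      coloured-window : DepthWindow (has t (pos t)) (length r) (length r + k)
      coloured-window c≢0 has-c with present⇒neighbour G (col t) (pos t) has-c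
      ... | b , uAb , refl = depth b , colour-depth c≢0
                           , subst (_< depth b + k) (proj₁ stack-heights) (edge-depth c≢0 u-coloured (Adj-sym G uAb))
                           , subst (λ d → depth b < d + k) (proj₁ stack-heights) (edge-depth u-coloured c≢0 uAb)

      decision : dec t ≡ dfsStep (has t (pos t)) (length r)
      decision = trans (cong (λ c → decide c (has t (pos t))) (top-colour labelling stack-heights stack-coloured))
        (decide-coloured (length r) coloured-window
          (parent-present {t} r labelling (proj₂ stack-heights) (All.tail stack-coloured) (linked⇒nextTo r stack-path)))

    module Step {t c₁ d} (run : Runs t) (eq : dec t ≡ just (c₁ , d)) where

      moved : Adj G (pos t) (pos (suc t))
      moved = proj₁ (valid t c₁ d run eq)

      target-colour : col t (pos (suc t)) ≡ d
      target-colour = proj₂ (valid t c₁ d run eq)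

      target-colour′ : col (suc t) (pos (suc t)) ≡ d
      target-colour′ = trans (colour-kept {w = pos (suc t)} eq (λ b≡u → ⊥-elim (Adj⇒≢ G moved (sym b≡u)))) target-colour

      visited-step : (∀ {w} → Coloured (col t) w → ∃ λ s → s ≤ t × pos s ≡ w) →
                     ∀ {w} → Coloured (col (suc t)) w → ∃ λ s → s ≤ suc t × pos s ≡ w
      visited-step visited {w} w-col with toSum (w Fin.≟ pos t)
      ... | inj₁ refl = t , n≤1+n t , refl
      ... | inj₂ w≢u with s , s≤t , at ← visited (w-col ∘ trans (colour-kept {w = w} eq (⊥-elim ∘ w≢u))) =
        s , m≤n⇒m≤1+n s≤t , at

    module EnterStep {t stack d} (S : DfsState t stack) (u0 : col t (pos t) ≡ 0) (att : AttachedTo stack (pos t))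
                     (run : Runs t) (eq : dec t ≡ just (depthColour (length stack) , d)) where
      open DfsState S
      open Entering S
      open Step run eq public

      depth′ : V → ℕ
      depth′ = update G depth (pos t) (length stack)

      u-coloured′ : Coloured (col (suc t)) (pos t)
      u-coloured′ = depthColour≢0 (length stack) ∘ trans (sym (trans (colour-step eq (pos t)) (update-same G (col t) (pos t) _)))

      was-coloured : ∀ {w} → w ≢ pos t → Coloured (col (suc t)) w → Coloured (col t) w
      was-coloured {w} w≢u w-col = w-col ∘ trans (colour-kept {w = w} eq (⊥-elim ∘ w≢u))

      labelling′ : Labelling (col (suc t)) depth′
      labelling′ = labelling-cong (colour-step eq)
        (labelling-extend labelling (neighbour-window u0 att) parent (attached-root stack att))
        where
        parent : ∀ {x x′} → Coloured (col t) x → Coloured (col t) x′ → Adj G (pos t) x → Adj G (pos t) x′ →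
                 suc (depth x) ≡ length stack → suc (depth x′) ≡ length stack → x ≡ x′
        parent x-col x′-col uAx uAx′ =
          heights-top-unique stack-heights (neighbour-on-stack u0 uAx x-col) (neighbour-on-stack u0 uAx′ x′-col)

      stack-heights′ : Heights depth′ stack
      stack-heights′ = heights-cong (λ x∈ → update-other G depth _ (All.lookup (off-stack u0) x∈ ∘ sym)) stack-heights

      stack-coloured′ : All (Coloured (col (suc t))) stack
      stack-coloured′ = All.map (stays-coloured eq) stack-coloured

      finished-elsewhere : ∀ {w b} → Coloured (col (suc t)) w → w ≢ pos t → w ∉ stack → Adj G w b → Coloured (col (suc t)) b
      finished-elsewhere w-col w≢u w∉ wAb = stays-coloured eq (finished (was-coloured w≢u w-col) w∉ wAb)

      uncoloured-drop : 3 * uncoloured t ≡ 3 + 3 * uncoloured (suc t)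
      uncoloured-drop = trans (cong (3 *_) (countTrue-drop _ _ (≡⇒≡ᵇ _ 0 u0) (u-coloured′ ∘ ≡ᵇ⇒≡ _ 0)
                                (λ w w≢u → cong (_≡ᵇ 0) (sym (colour-kept {w = w} eq (⊥-elim ∘ w≢u))))))
                              (*-suc 3 _)

    enter-descend : ∀ {t stack} (S : DfsState t stack) (u0 : col t (pos t) ≡ 0) (att : AttachedTo stack (pos t)) →
                    Runs t → dec t ≡ just (depthColour (length stack) , 0) →
                    t + (3 * uncoloured t + length stack) ≤ 3 * n → DfsState (suc t) (pos t ∷ stack)
    enter-descend {t} {stack} S u0 att run eq budget = record
      { depth          = depth′
      ; labelling      = labelling′
      ; stack-path     = push-linked stack att stack-path
      ; stack-unique   = off-stack u0 ∷ stack-unique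
      ; stack-heights  = update-same G depth (pos t) (length stack) , stack-heights′
      ; stack-coloured = u-coloured′ ∷ stack-coloured′
      ; finished       = λ w-col w∉ → finished-elsewhere w-col (w∉ ∘ here) (w∉ ∘ there)
      ; visited        = visited-step visited
      ; phase          = entering target-colour′ moved
      ; budget         = budget-step {t} shrinks budget
      }
      where
      open DfsState S hiding (budget)
      open Entering S
      open EnterStep S u0 att run eq
      open ≤-Reasoning
      shrinks : suc (3 * uncoloured (suc t) + suc (length stack)) ≤ 3 * uncoloured t + length stack
      shrinks = begin
        suc (3 * uncoloured (suc t) + suc (length stack))  ≡⟨ cong suc (+-suc _ (length stack)) ⟩
        2 + (3 * uncoloured (suc t) + length stack)        ≤⟨ n≤1+n _ ⟩
        3 + (3 * uncoloured (suc t) + length stack)        ≡⟨ +-assoc 3 _ (length stack) ⟨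
        3 + 3 * uncoloured (suc t) + length stack          ≡⟨ cong (_+ length stack) uncoloured-drop ⟨
        3 * uncoloured t + length stack                    ∎

    enter-retreat : ∀ {t y r} (S : DfsState t (y ∷ r)) (u0 : col t (pos t) ≡ 0) (att : AttachedTo (y ∷ r) (pos t)) →
                    Runs t → dec t ≡ just (depthColour (suc (length r)) , depthColour (length r)) →
                    ¬ T (has t (pos t) 0) → t + (3 * uncoloured t + suc (length r)) ≤ 3 * n → DfsState (suc t) (y ∷ r)
    enter-retreat {t} {y} {r} S u0 att run eq ¬has0 budget = record
      { depth          = depth′
      ; labelling      = labelling′
      ; stack-path     = stack-path
      ; stack-unique   = stack-unique
      ; stack-heights  = stack-heights′
      ; stack-coloured = stack-coloured′
      ; finished       = finished′
      ; visited        = visited-step visited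
      ; phase          = atTop (sym target-is-top)
      ; budget         = budget-step {t} shrinks budget
      }
      where
      open DfsState S hiding (budget)
      open Entering S
      open EnterStep S u0 att run eq

      target-coloured : Coloured (col t) (pos (suc t))
      target-coloured = depthColour≢0 (length r) ∘ trans (sym target-colour)

      window : depth (pos (suc t)) < suc (length r) × suc (length r) < depth (pos (suc t)) + k
      window = neighbour-window u0 att moved target-coloured

      target-depth : depth (pos (suc t)) ≡ length r
      target-depth = depthColour-injective (trans (sym (colour-depth target-coloured)) target-colour)
        (<-≤-trans (proj₁ window) (m<m+n (length r) z<s))
        (<-trans (n<1+n (length r)) (<-≤-trans (proj₂ window) (+-monoʳ-≤ _ k≤period)))

      target-is-top : pos (suc t) ≡ y
      target-is-top = heights-top stack-heights (neighbour-on-stack u0 moved target-coloured)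
                                   (trans target-depth (sym (proj₁ stack-heights)))

      finished′ : ∀ {w b} → Coloured (col (suc t)) w → w ∉ y ∷ r → Adj G w b → Coloured (col (suc t)) b
      finished′ {w} w-col w∉ wAb with toSum (w Fin.≟ pos t)
      ... | inj₁ refl = stays-coloured eq (neighbours-coloured {t} ¬has0 wAb)
      ... | inj₂ w≢u  = finished-elsewhere w-col w≢u w∉ wAb

      open ≤-Reasoning
      shrinks : suc (suc (3 * uncoloured (suc t) + suc (length r))) ≤ 3 * uncoloured t + suc (length r)
      shrinks = begin
        2 + (3 * uncoloured (suc t) + suc (length r))  ≤⟨ n≤1+n _ ⟩
        3 + (3 * uncoloured (suc t) + suc (length r))  ≡⟨ +-assoc 3 _ (suc (length r)) ⟨
        3 + 3 * uncoloured (suc t) + suc (length r)    ≡⟨ cong (_+ suc (length r)) uncoloured-drop ⟨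
        3 * uncoloured t + suc (length r)              ∎

    module TopStep {t r c₁ d} (S : DfsState t (pos t ∷ r)) (run : Runs t) (eq : dec t ≡ just (c₁ , d)) where
      open DfsState S
      open AtTop S
      open Step run eq public

      unchanged : ∀ w → col (suc t) w ≡ col t w
      unchanged w = colour-kept {w = w} eq (λ { refl → u-coloured })

      labelling′ : Labelling (col (suc t)) depth
      labelling′ = labelling-cong unchanged labelling

      was-coloured : ∀ {w} → Coloured (col (suc t)) w → Coloured (col t) w
      was-coloured {w} w-col = w-col ∘ trans (unchanged w)

      uncoloured-same : uncoloured (suc t) ≡ uncoloured t
      uncoloured-same = countTrue-cong (λ w → cong (_≡ᵇ 0) (unchanged w))

    top-descend : ∀ {t r} (S : DfsState t (pos t ∷ r)) → Runs t →
                  dec t ≡ just (depthColour (length r) , 0) →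
                  t + suc (3 * uncoloured t + suc (length r)) ≤ 3 * n → DfsState (suc t) (pos t ∷ r)
    top-descend {t} {r} S run eq budget = record
      { depth          = depth
      ; labelling      = labelling′
      ; stack-path     = stack-path
      ; stack-unique   = stack-unique
      ; stack-heights  = stack-heights
      ; stack-coloured = All.map (stays-coloured eq) stack-coloured
      ; finished       = λ w-col w∉ wAb → stays-coloured eq (finished (was-coloured w-col) w∉ wAb)
      ; visited        = visited-step visited
      ; phase          = entering target-colour′ moved
      ; budget         = budget-step {t} (≤-reflexive (cong (λ U → suc (3 * U + suc (length r))) uncoloured-same)) budget
      }
      where
      open DfsState S hiding (budget)
      open TopStep S run eq

    top-retreat : ∀ {t y r} (S : DfsState t (pos t ∷ y ∷ r)) → Runs t →
                  dec t ≡ just (depthColour (suc (length r)) , depthColour (length r)) → ¬ T (has t (pos t) 0) →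
                  t + suc (3 * uncoloured t + suc (suc (length r))) ≤ 3 * n → DfsState (suc t) (y ∷ r)
    top-retreat {t} {y} {r} S run eq ¬has0 budget = record
      { depth          = depth
      ; labelling      = labelling′
      ; stack-path     = Linked.tail stack-path
      ; stack-unique   = AllPairs.tail stack-unique
      ; stack-heights  = proj₂ stack-heights
      ; stack-coloured = All.map (stays-coloured eq) (All.tail stack-coloured)
      ; finished       = finished′
      ; visited        = visited-step visited
      ; phase          = atTop (sym target-is-parent)
      ; budget         = budget-step {t} shrinks budget
      }
      where
      open DfsState S hiding (budget)
      open AtTop S
      open TopStep S run eq

      target-coloured : Coloured (col t) (pos (suc t))
      target-coloured = depthColour≢0 (length r) ∘ trans (sym target-colour)

      depth-u : depth (pos t) ≡ suc (length r)
      depth-u = proj₁ stack-heights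

      target-depth : depth (pos (suc t)) ≡ length r
      target-depth = depthColour-injective (trans (sym (colour-depth target-coloured)) target-colour)
        (<-≤-trans (subst (λ e → depth (pos (suc t)) < e + k) depth-u (edge-depth u-coloured target-coloured moved))
                   (≤-trans (≤-reflexive (sym (+-suc (length r) k))) (+-monoʳ-≤ (length r) k<period)))
        (<-trans (n<1+n (length r))
                 (<-≤-trans (subst (_< depth (pos (suc t)) + k) depth-u
                                   (edge-depth target-coloured u-coloured (Adj-sym G moved)))
                            (+-monoʳ-≤ _ k≤period)))

      target-is-parent : pos (suc t) ≡ y
      target-is-parent = parent-unique u-coloured target-coloured (All.head (All.tail stack-coloured))
        moved (Linked.head stack-path)
        (trans (cong suc target-depth) (sym depth-u)) (trans (cong suc (proj₁ (proj₂ stack-heights))) (sym depth-u))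

      finished′ : ∀ {w b} → Coloured (col (suc t)) w → w ∉ y ∷ r → Adj G w b → Coloured (col (suc t)) b
      finished′ {w} w-col w∉ wAb with toSum (w Fin.≟ pos t)
      ... | inj₁ refl = stays-coloured eq (neighbours-coloured {t} ¬has0 wAb)
      ... | inj₂ w≢u  = stays-coloured eq (finished (was-coloured w-col) w∉u∷y∷r wAb)
        where
        w∉u∷y∷r : w ∉ pos t ∷ y ∷ r
        w∉u∷y∷r (here w≡u)  = w≢u w≡u
        w∉u∷y∷r (there w∈) = w∉ w∈

      open ≤-Reasoning
      shrinks : suc (suc (3 * uncoloured (suc t) + suc (length r))) ≤ suc (3 * uncoloured t + suc (suc (length r)))
      shrinks = begin
        suc (suc (3 * uncoloured (suc t) + suc (length r)))  ≡⟨ cong (λ U → 2 + (3 * U + suc (length r))) uncoloured-same ⟩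
        suc (suc (3 * uncoloured t + suc (length r)))        ≡⟨ cong suc (+-suc _ (suc (length r))) ⟨
        suc (3 * uncoloured t + suc (suc (length r)))        ∎

    enter : ∀ {t stack c₁ d} (S : DfsState t stack) → col t (pos t) ≡ 0 → AttachedTo stack (pos t) →
            t + (3 * uncoloured t + length stack) ≤ 3 * n → Runs t → dec t ≡ just (c₁ , d) →
            DfsMove (has t (pos t)) (length stack) (just (c₁ , d)) → ∃ (DfsState (suc t))
    enter                   S u0 att budget run eq (descend _)          = _ , enter-descend S u0 att run eq budget
    enter {stack = []}      S u0 att budget run eq (retreat _ ())
    enter {stack = _ ∷ _}   S u0 att budget run eq (retreat ¬has0 refl) = _ , enter-retreat S u0 att run eq ¬has0 budget

    leave-top : ∀ {t r c₁ d} (S : DfsState t (pos t ∷ r)) → t + suc (3 * uncoloured t + suc (length r)) ≤ 3 * n →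
                Runs t → dec t ≡ just (c₁ , d) →
                DfsMove (has t (pos t)) (length r) (just (c₁ , d)) → ∃ (DfsState (suc t))
    leave-top               S budget run eq (descend _)          = _ , top-descend S run eq budget
    leave-top {r = []}      S budget run eq (retreat _ ())
    leave-top {r = _ ∷ _}   S budget run eq (retreat ¬has0 refl) = _ , top-retreat S run eq ¬has0 budget

    advance : ∀ {t stack c₁ d} → DfsState t stack → Runs t → dec t ≡ just (c₁ , d) → ∃ (DfsState (suc t))
    advance S run eq with DfsState.phase S | DfsState.budget S
    ... | entering u0 att | budget =
      enter S u0 att budget run eq (subst (DfsMove _ _) (trans (sym (Entering.decision S u0 att)) eq) (dfsMove _ _))
    ... | atTop refl      | budget =
      leave-top S budget run eq (subst (DfsMove _ _) (trans (sym (AtTop.decision S)) eq) (dfsMove _ _))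

    Explored-at : ℕ → Set
    Explored-at t = pos t ≡ pos 0 × (∀ v → ∃ λ s → s ≤ t × pos s ≡ v)

    halted-entering : ∀ {t stack} (S : DfsState t stack) → Connected G → col t (pos t) ≡ 0 → AttachedTo stack (pos t) →
                      DfsMove (has t (pos t)) (length stack) nothing → Explored-at t
    halted-entering {t} {stack} S connected u0 att (halt ¬has0 empty) =
      attached-root stack att empty , λ v → isolated (connected (pos t) v)
      where
      open Entering S
      isolated : ∀ {v} → Walk G (pos t) v → ∃ λ s → s ≤ t × pos s ≡ v
      isolated here         = t , ≤-refl , refl
      isolated (step uAb _) =
        ⊥-elim (<⇒≢ (∈-length (neighbour-on-stack u0 uAb (neighbours-coloured {t} ¬has0 uAb))) (sym empty))

    halted-top : ∀ {t r} (S : DfsState t (pos t ∷ r)) → Connected G → DfsMove (has t (pos t)) (length r) nothing →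
                 Explored-at t
    halted-top {t} {[]} S connected (halt ¬has0 _) =
      depth0-root u-coloured (proj₁ stack-heights) , λ v → visited (walk-closed G closed (connected (pos t) v) u-coloured)
      where
      open DfsState S
      open AtTop S
      closed : ∀ {w b} → Coloured (col t) w → Adj G w b → Coloured (col t) b
      closed {w} w-col wAb with toSum (w Fin.≟ pos t)
      ... | inj₁ refl = neighbours-coloured {t} ¬has0 wAb
      ... | inj₂ w≢u  = finished w-col (λ { (here w≡u) → w≢u w≡u }) wAb
    halted-top {r = _ ∷ _} S connected (halt _ ())

    halted : ∀ {t stack} → DfsState t stack → Connected G → dec t ≡ nothing → Explored-at t
    halted S connected stop with DfsState.phase S
    ... | entering u0 att =
      halted-entering S connected u0 att (subst (DfsMove _ _) (trans (sym (Entering.decision S u0 att)) stop) (dfsMove _ _))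
    ... | atTop refl =
      halted-top S connected (subst (DfsMove _ _) (trans (sym (AtTop.decision S)) stop) (dfsMove _ _))

    reachable : ∀ t → Runs t → ∃ (DfsState t)
    reachable zero    _   = [] , initial
    reachable (suc t) run with dec t in eq
    ... | nothing = ⊥-elim (run t (n<1+n t) eq)
    ... | just _  = advance (proj₂ (reachable t run′)) run′ eq
      where
      run′ : Runs t
      run′ s s<t = run s (m<n⇒m<1+n s<t)

    time-bound : ∀ {t stack} → DfsState t stack → t ≤ 3 * n
    time-bound S = ≤-trans (m≤m+n _ _) (DfsState.budget S)

    explores : Connected G → Explored G dfsExplorer pos
    explores connected with halts-or-runs (suc (3 * n))
    ... | inj₁ run              = ⊥-elim (1+n≰n (time-bound (proj₂ (reachable _ run))))
    ... | inj₂ (t , run , stop) = t , run , stop , halted (proj₂ (reachable t run)) connected stop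

theorem8 : ∀ (k : ℕ) → 3 ≤ k →
    ∃ λ (A : Algorithm) → ∀ (G : Graph) → Connected G → CircumferenceAtMost G k →
    SuccessfullyExplores G A × AssignsColorsAtMost G (2 * k ∸ 1) A
theorem8 (suc (suc (suc j))) (s≤s (s≤s (s≤s z≤n))) = dfsExplorer , λ G connected circ →
    (λ pos valid → DfsRun.Invariant.explores j G pos circ valid connected)
  , (λ pos _ → subst (ColorsAtMost G dfsExplorer pos) rootColour≡2k-1 (DfsRun.colours-bounded j G pos))
  where open DfsExplorer j
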